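{- Let $B,D\subseteq\mathbb{Z}_m$ be $2$-$\{m;k_1,k_2;\mu\}$ supplementary difference sets. (i) If for some $b\in B$ the sets $B\setminus\{b\}$ and $D$ are $2$-$\{m;k_1-1,k_2;\mu-1;\frac{m-1}{2}\}$ ASDS, then $k_1=(m+3)/4$ and $\mu=(m+3)/16+(k_2^2-k_2)/(m-1)$. (ii) If for some $b\in\mathbb{Z}_m\setminus(B\cup D)$ the sets $B\cup\{b\}$ and $D$ are $2$-$\{m;k_1+1,k_2;\mu;\frac{m-1}{2}\}$ ASDS, then $k_1=(m-1)/4$ and $\mu=(m-5)/16+(k_2^2-k_2)/(m-1)$.
   Context: For $B,D\subseteq\mathbb{Z}_m$ and $a\in\mathbb{Z}_m$, $N(a)=|\{(x,x')\in B\times B:x-x'\equiv a\bmod m\}|+|\{(y,y')\in D\times D:y-y'\equiv a\bmod m\}|$. $B,D$ are $2$-$\{m;k_1,k_2;\mu\}$ SDS (supplementary difference sets) if $|B|=k_1$, $|D|=k_2$ and $N(a)=\mu$ for all $a\ne0$. They are $2$-$\{m;k_1,k_2;\mu;t\}$ ASDS if $|B|=k_1$, $|D|=k_2$, $N(a)\in\{\mu,\mu+1\}$ for all $a\ne0$, and exactly $t$ of the nonzero $a$ satisfy $N(a)=\mu$. -}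

module Defs where

open import Data.Nat as ℕ using (ℕ; _≟_)
open import Data.Nat.Divisibility using (_∣?_)
open import Data.Integer as ℤ using (ℤ; +_)
open import Data.Integer.Divisibility as ℤD using ()
open import Data.Fin using (Fin; toℕ)
open import Data.Fin.Subset using (Subset; _∈_; ∣_∣)
open import Data.Fin.Subset.Properties using (_∈?_)
open import Data.List using (List; length; filter; cartesianProduct; allFin)
open import Data.Product using (_×_; _,_)
open import Data.Sum using (_⊎_)
open import Relation.Binary.PropositionalEquality using (_≡_; _≢_)
open import Relation.Nullary using (¬_)
open import Relation.Nullary.Decidable using (_×-dec_; ¬?)

DiffMod : (m : ℕ) → Fin m → Fin m → Fin m → Set
DiffMod m x x' a = (+ m) ℤD.∣ ((+ toℕ x ℤ.- + toℕ x') ℤ.- + toℕ a)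

pairCount : (m : ℕ) → Subset m → Fin m → ℕ
pairCount m S a =
  length (filter (λ { (x , x') → (x ∈? S) ×-dec ((x' ∈? S) ×-dec (m ∣? ℤ.∣ (+ toℕ x ℤ.- + toℕ x') ℤ.- + toℕ a ∣)) })
                 (cartesianProduct (allFin m) (allFin m)))

N : (m : ℕ) → Subset m → Subset m → Fin m → ℕ
N m B D a = pairCount m B a ℕ.+ pairCount m D a

NonZeroElt : {m : ℕ} → Fin m → Set
NonZeroElt a = ¬ (toℕ a ≡ 0)

SDS : (m : ℕ) → Subset m → Subset m → ℕ → ℕ → ℕ → Set
SDS m B D k₁ k₂ μ =
  ∣ B ∣ ≡ k₁ × ∣ D ∣ ≡ k₂ × (∀ (a : Fin m) → NonZeroElt a → N m B D a ≡ μ)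

-- 2-{m;k1,k2;μ;t} almost supplementary difference sets (μ taken in ℤ so μ-1 is exact)
ASDS : (m : ℕ) → Subset m → Subset m → ℕ → ℕ → ℤ → ℕ → Set
ASDS m B D k₁ k₂ μ t =
  ∣ B ∣ ≡ k₁ × ∣ D ∣ ≡ k₂
  × (∀ (a : Fin m) → NonZeroElt a → (+ N m B D a ≡ μ) ⊎ (+ N m B D a ≡ μ ℤ.+ + 1))
  × length (filter (λ a → ¬? (toℕ a ≟ 0) ×-dec (+ N m B D a ℤ.≟ μ)) (allFin m)) ≡ t

-- For S ⊆ ℤ_m every ordered pair (x, x') ∈ S × S has exactly one difference a ≡ x − x', and a = 0
-- exactly when x = x'; hence Σ_{a≠0} |{(x,x') ∈ S² : x − x' ≡ a}| = |S|(|S| − 1). Summing N over the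
-- nonzero residues thus gives k₁(k₁ − 1) + k₂(k₂ − 1) = (m − 1)μ for an SDS, and (m − 1)(μ' + 1) − t
-- for an ASDS with levels μ', μ' + 1. Comparing the two sums, removing a point of B lowers the total
-- by 2(k₁ − 1), which must equal t = (m − 1)/2, while adding a point raises it by 2k₁, which must
-- equal (m − 1) − t = t. This pins down k₁, and then μ = (k₁(k₁ − 1) + k₂(k₂ − 1))/(m − 1).
module Submission where

open import Defs
open import Data.Nat as ℕ using (ℕ; zero; suc; _+_; _*_; _∸_; _<_; _≟_; NonZero)
import Data.Nat.Properties as ℕP
import Data.Nat.Divisibility as ℕD
open import Data.Nat.Tactic.RingSolver using (solve-∀)
open import Data.Integer as ℤ using (ℤ; +_; 1ℤ; _%ℕ_; _/ℕ_)
import Data.Integer.Properties as ℤP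
import Data.Integer.Divisibility as ℤD
import Data.Integer.Divisibility.Signed as ℤS
open import Data.Integer.DivMod using (n%ℕd<d; a≡a%ℕn+[a/ℕn]*n)
import Data.Integer.Tactic.RingSolver as ℤ-Solver
open import Data.Rational as ℚ using (_/_; toℚᵘ)
import Data.Rational.Properties as ℚP
open import Data.Rational.Unnormalised as ℚᵘ using (mkℚᵘ; *≡*)
import Data.Rational.Unnormalised.Properties as ℚᵘP
open import Data.Bool using (true; false; if_then_else_)
open import Data.Fin as Fin using (Fin; toℕ; fromℕ<)
import Data.Fin.Properties as FP
open import Data.Fin.Subset using (Subset; _∈_; _∉_; _∪_; _-_; ⁅_⁆; ∣_∣; inside; outside)
open import Data.Fin.Subset.Properties using (_∈?_)
open import Data.List using (length; filter; tabulate; allFin; cartesianProduct; map; _++_)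
import Data.List.Properties as LP
open import Data.Vec using ([]; _∷_)
open import Data.Product using (_×_; _,_; proj₁; proj₂; ∃-syntax)
open import Data.Sum using (_⊎_; inj₁; inj₂)
open import Function using (id; _∘_; case_of_)
open import Relation.Nullary using (Dec; yes; no; does; ¬_; contradiction)
open import Relation.Nullary.Decidable using (_×-dec_; ¬?)
open import Relation.Unary using (Pred; Decidable)
open import Relation.Binary.PropositionalEquality
open import Algebra.Properties.Semiring.Sum ℕP.+-*-semiring
  using (sum-syntax; sum-cong-≗; ∑-comm; ∑-distrib-+; *-distribˡ-sum; *-distribʳ-sum)
open import Algebra.Properties.CommutativeSemigroup ℕP.+-commutativeSemigroup using (xy∙z≈xz∙y)
open import Algebra.Properties.AbelianGroup ℤP.+-0-abelianGroup using (xyx⁻¹≈y; //-rightDividesˡ; //-rightDividesʳ)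

𝟙 : ∀ {p} {P : Set p} → Dec P → ℕ
𝟙 d = if does d then 1 else 0

𝟙-×-dec : ∀ {p q} {P : Set p} {Q : Set q} (P? : Dec P) (Q? : Dec Q) → 𝟙 (P? ×-dec Q?) ≡ 𝟙 P? * 𝟙 Q?
𝟙-×-dec (yes _) Q? = sym (ℕP.*-identityˡ (𝟙 Q?))
𝟙-×-dec (no _)  Q? = refl

𝟙-idem : ∀ {p} {P : Set p} (P? : Dec P) → 𝟙 P? * 𝟙 P? ≡ 𝟙 P?
𝟙-idem (yes _) = refl
𝟙-idem (no _)  = refl

∑-const : ∀ n c → ∑[ i < n ] c ≡ n * c
∑-const zero    c = refl
∑-const (suc n) c = cong (λ s → c + s) (∑-const n c)

∑-𝟙-none : ∀ {p n} {P : Pred (Fin n) p} (P? : Decidable P) → (∀ i → ¬ P i) → ∑[ i < n ] 𝟙 (P? i) ≡ 0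
∑-𝟙-none {n = n} P? ¬P = trans (sum-cong-≗ 𝟙≡0) (trans (∑-const n 0) (ℕP.*-zeroʳ n))
  where
  𝟙≡0 : ∀ i → 𝟙 (P? i) ≡ 0
  𝟙≡0 i with P? i
  ... | yes Pi = contradiction Pi (¬P i)
  ... | no _   = refl

∑-𝟙-unique : ∀ {p n} {P : Pred (Fin n) p} (P? : Decidable P) {c} →
             P c → (∀ {i} → P i → i ≡ c) → ∑[ i < n ] 𝟙 (P? i) ≡ 1
∑-𝟙-unique {n = suc n} P? {Fin.zero} Pc unique with P? Fin.zero
... | yes _  = cong suc (∑-𝟙-none (P? ∘ Fin.suc) (λ i Psi → FP.0≢1+n (sym (unique Psi))))
... | no ¬P0 = contradiction Pc ¬P0
∑-𝟙-unique {n = suc n} P? {Fin.suc c} Pc unique with P? Fin.zero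
... | yes P0 = case unique P0 of λ ()
... | no _   = ∑-𝟙-unique (P? ∘ Fin.suc) Pc (FP.suc-injective ∘ unique)

∑-*𝟙-unique : ∀ {p n} {P : Pred (Fin n) p} (P? : Decidable P) {c} →
              P c → (∀ {i} → P i → i ≡ c) → (f : Fin n → ℕ) → ∑[ i < n ] (f i * 𝟙 (P? i)) ≡ f c
∑-*𝟙-unique {n = n} P? {c} Pc unique f = begin
  ∑[ i < n ] (f i * 𝟙 (P? i))  ≡⟨ sum-cong-≗ at-c ⟩
  ∑[ i < n ] (f c * 𝟙 (P? i))  ≡⟨ *-distribˡ-sum (f c) (𝟙 ∘ P?) ⟨
  f c * ∑[ i < n ] 𝟙 (P? i)    ≡⟨ cong (f c *_) (∑-𝟙-unique P? Pc unique) ⟩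
  f c * 1                      ≡⟨ ℕP.*-identityʳ (f c) ⟩
  f c                          ∎
  where
  open ≡-Reasoning
  at-c : ∀ i → f i * 𝟙 (P? i) ≡ f c * 𝟙 (P? i)
  at-c i with P? i
  ... | yes Pi = cong (λ j → f j * 1) (unique Pi)
  ... | no _   = trans (ℕP.*-zeroʳ (f i)) (sym (ℕP.*-zeroʳ (f c)))

module _ {a p} {A : Set a} {P : Pred A p} (P? : Decidable P) where

  length-filter-tabulate : ∀ {n} (f : Fin n → A) →
                           length (filter P? (tabulate f)) ≡ ∑[ i < n ] 𝟙 (P? (f i))
  length-filter-tabulate {zero}  f = refl
  length-filter-tabulate {suc n} f with does (P? (f Fin.zero))
  ... | true  = cong suc (length-filter-tabulate (f ∘ Fin.suc))
  ... | false = length-filter-tabulate (f ∘ Fin.suc)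

  length-filter-++ : ∀ xs ys → length (filter P? (xs ++ ys)) ≡ length (filter P? xs) + length (filter P? ys)
  length-filter-++ xs ys = trans (cong length (LP.filter-++ P? xs ys)) (LP.length-++ (filter P? xs))

length-filter-cartesianProduct :
  ∀ {a b p} {A : Set a} {B : Set b} {P : Pred (A × B) p} (P? : Decidable P) {m n} (f : Fin m → A) (g : Fin n → B) →
  length (filter P? (cartesianProduct (tabulate f) (tabulate g))) ≡ ∑[ i < m ] ∑[ j < n ] 𝟙 (P? (f i , g j))
length-filter-cartesianProduct P? {zero}  f g = refl
length-filter-cartesianProduct P? {suc m} {n} f g = begin
  length (filter P? (row ++ rest))                  ≡⟨ length-filter-++ P? row rest ⟩
  length (filter P? row) + length (filter P? rest)
    ≡⟨ cong (λ r → length (filter P? r) + length (filter P? rest)) (LP.map-tabulate g (f Fin.zero ,_)) ⟩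
  length (filter P? (tabulate ((f Fin.zero ,_) ∘ g))) + length (filter P? rest)
    ≡⟨ cong₂ _+_ (length-filter-tabulate P? ((f Fin.zero ,_) ∘ g)) (length-filter-cartesianProduct P? (f ∘ Fin.suc) g) ⟩
  ∑[ j < n ] 𝟙 (P? (f Fin.zero , g j)) + ∑[ i < m ] ∑[ j < n ] 𝟙 (P? (f (Fin.suc i) , g j)) ∎
  where
  open ≡-Reasoning
  row  = map (f Fin.zero ,_) (tabulate g)
  rest = cartesianProduct (tabulate (f ∘ Fin.suc)) (tabulate g)

∣-<⇒≡0 : ∀ {m n} → m ℕD.∣ n → n < m → n ≡ 0
∣-<⇒≡0 {n = zero}  _   _   = refl
∣-<⇒≡0 {n = suc n} m∣n n<m = contradiction m∣n (ℕD.>⇒∤ n<m)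

residue-injective : ∀ {m i j} → i < m → j < m → + m ℤD.∣ + i ℤ.- + j → i ≡ j
residue-injective {m} {i} {j} i<m j<m m∣i-j =
  ℤP.+-injective (ℤP.i-j≡0⇒i≡j (+ i) (+ j) (ℤP.∣i∣≡0⇒i≡0 (∣-<⇒≡0 m∣i-j ∣i-j∣<m)))
  where
  ∣i-j∣<m : ℤ.∣ + i ℤ.- + j ∣ < m
  ∣i-j∣<m = subst (_< m) (cong ℤ.∣_∣ (sym (ℤP.[+m]-[+n]≡m⊖n i j)))
              (ℕP.≤-<-trans (ℤP.∣m⊝n∣≤m⊔n i j) (ℕP.⊔-lub i<m j<m))

diffMod? : ∀ m (x x' a : Fin m) → Dec (DiffMod m x x' a)
diffMod? m x x' a = m ℕD.∣? ℤ.∣ (+ toℕ x ℤ.- + toℕ x') ℤ.- + toℕ a ∣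

DiffMod-unique : ∀ {m} {x x' a b : Fin m} → DiffMod m x x' a → DiffMod m x x' b → a ≡ b
DiffMod-unique {m} {x} {x'} {a} {b} da db =
  FP.toℕ-injective (residue-injective (FP.toℕ<n a) (FP.toℕ<n b) (subst (+ m ℤD.∣_) (cancel u (+ toℕ a) (+ toℕ b)) m∣diff))
  where
  u = + toℕ x ℤ.- + toℕ x'
  m∣diff : + m ℤD.∣ (u ℤ.- + toℕ b) ℤ.- (u ℤ.- + toℕ a)
  m∣diff = ℤS.∣⇒∣ᵤ (ℤS.∣m∣n⇒∣m-n (ℤS.∣ᵤ⇒∣ {+ m} {u ℤ.- + toℕ b} db) (ℤS.∣ᵤ⇒∣ {+ m} {u ℤ.- + toℕ a} da))
  cancel : ∀ u p q → (u ℤ.- q) ℤ.- (u ℤ.- p) ≡ p ℤ.- q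
  cancel = ℤ-Solver.solve-∀

DiffMod-exists : ∀ {n} (x x' : Fin (suc n)) → ∃[ a ] DiffMod (suc n) x x' a
DiffMod-exists {n} x x' = fromℕ< r<m , subst (+ suc n ℤD.∣_) q*m≡u-r (ℤS.∣⇒∣ᵤ (ℤS.∣n⇒∣m*n q (ℤS.∣-refl {+ suc n})))
  where
  u = + toℕ x ℤ.- + toℕ x'
  q = u /ℕ suc n
  r<m = n%ℕd<d u (suc n)
  q*m≡u-r : q ℤ.* + suc n ≡ u ℤ.- + toℕ (fromℕ< r<m)
  q*m≡u-r = begin
    q ℤ.* + suc n                                              ≡⟨ xyx⁻¹≈y (+ (u %ℕ suc n)) (q ℤ.* + suc n) ⟨
    (+ (u %ℕ suc n) ℤ.+ q ℤ.* + suc n) ℤ.- + (u %ℕ suc n)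
      ≡⟨ cong₂ ℤ._-_ (a≡a%ℕn+[a/ℕn]*n u (suc n)) (cong +_ (FP.toℕ-fromℕ< r<m)) ⟨
    u ℤ.- + toℕ (fromℕ< r<m)                                   ∎
    where open ≡-Reasoning

DiffMod-refl : ∀ {n} (x : Fin (suc n)) → DiffMod (suc n) x x Fin.zero
DiffMod-refl {n} x = subst (+ suc n ℤD.∣_) (sym (trans (ℤP.+-identityʳ _) (ℤP.+-inverseʳ (+ toℕ x)))) (suc n ℕD.∣0)

DiffMod-zero⇒≡ : ∀ {n} {x x' : Fin (suc n)} → DiffMod (suc n) x x' Fin.zero → x ≡ x'
DiffMod-zero⇒≡ {n} {x} {x'} d = FP.toℕ-injective (residue-injective (FP.toℕ<n x) (FP.toℕ<n x')
  (subst (+ suc n ℤD.∣_) (ℤP.+-identityʳ (+ toℕ x ℤ.- + toℕ x')) d))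

∑-𝟙-diffMod : ∀ {n} (x x' : Fin (suc n)) → ∑[ a < suc n ] 𝟙 (diffMod? (suc n) x x' a) ≡ 1
∑-𝟙-diffMod {n} x x' = ∑-𝟙-unique (diffMod? (suc n) x x') (proj₂ (DiffMod-exists x x'))
                         (λ d → DiffMod-unique {x = x} {x'} d (proj₂ (DiffMod-exists x x')))

∑-𝟙-∈ : ∀ {n} (S : Subset n) → ∑[ x < n ] 𝟙 (x ∈? S) ≡ ∣ S ∣
∑-𝟙-∈ []            = refl
∑-𝟙-∈ (inside ∷ S)  = cong suc (∑-𝟙-∈ S)
∑-𝟙-∈ (outside ∷ S) = ∑-𝟙-∈ S

module _ {m : ℕ} (S : Subset m) where

  pair? : (a x x' : Fin m) → Dec (x ∈ S × x' ∈ S × DiffMod m x x' a)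
  pair? a x x' = (x ∈? S) ×-dec ((x' ∈? S) ×-dec diffMod? m x x' a)

  pairCount≡∑ : ∀ a → pairCount m S a ≡ ∑[ x < m ] ∑[ x' < m ] 𝟙 (pair? a x x')
  pairCount≡∑ a = length-filter-cartesianProduct (λ p → pair? a (proj₁ p) (proj₂ p)) id id

  𝟙-pair? : ∀ a x x' → 𝟙 (pair? a x x') ≡ 𝟙 (x ∈? S) * (𝟙 (x' ∈? S) * 𝟙 (diffMod? m x x' a))
  𝟙-pair? a x x' = trans (𝟙-×-dec (x ∈? S) ((x' ∈? S) ×-dec diffMod? m x x' a))
                         (cong (𝟙 (x ∈? S) *_) (𝟙-×-dec (x' ∈? S) (diffMod? m x x' a)))

module _ {n : ℕ} (S : Subset (suc n)) where

  private
    m = suc n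

  ∑-𝟙-pair? : ∀ x x' → ∑[ a < m ] 𝟙 (pair? S a x x') ≡ 𝟙 (x ∈? S) * 𝟙 (x' ∈? S)
  ∑-𝟙-pair? x x' = begin
    ∑[ a < m ] 𝟙 (pair? S a x x')                        ≡⟨ sum-cong-≗ (λ a → 𝟙-pair? S a x x') ⟩
    ∑[ a < m ] (𝟙 (x ∈? S) * (𝟙 (x' ∈? S) * 𝟙 (d? a)))  ≡⟨ *-distribˡ-sum (𝟙 (x ∈? S)) (λ a → 𝟙 (x' ∈? S) * 𝟙 (d? a)) ⟨
    𝟙 (x ∈? S) * ∑[ a < m ] (𝟙 (x' ∈? S) * 𝟙 (d? a))    ≡⟨ cong (𝟙 (x ∈? S) *_) (*-distribˡ-sum (𝟙 (x' ∈? S)) (𝟙 ∘ d?)) ⟨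
    𝟙 (x ∈? S) * (𝟙 (x' ∈? S) * ∑[ a < m ] 𝟙 (d? a))    ≡⟨ cong (λ k → 𝟙 (x ∈? S) * (𝟙 (x' ∈? S) * k)) (∑-𝟙-diffMod x x') ⟩
    𝟙 (x ∈? S) * (𝟙 (x' ∈? S) * 1)                      ≡⟨ cong (𝟙 (x ∈? S) *_) (ℕP.*-identityʳ (𝟙 (x' ∈? S))) ⟩
    𝟙 (x ∈? S) * 𝟙 (x' ∈? S)                            ∎
    where
    open ≡-Reasoning
    d? = diffMod? m x x'

  ∑-pairCount : ∑[ a < m ] pairCount m S a ≡ ∣ S ∣ * ∣ S ∣
  ∑-pairCount = begin
    ∑[ a < m ] pairCount m S a                            ≡⟨ sum-cong-≗ (pairCount≡∑ S) ⟩
    ∑[ a < m ] ∑[ x < m ] ∑[ x' < m ] 𝟙 (pair? S a x x')  ≡⟨ ∑-comm (λ a x → ∑[ x' < m ] 𝟙 (pair? S a x x')) ⟩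
    ∑[ x < m ] ∑[ a < m ] ∑[ x' < m ] 𝟙 (pair? S a x x')  ≡⟨ sum-cong-≗ (λ x → ∑-comm (λ a x' → 𝟙 (pair? S a x x'))) ⟩
    ∑[ x < m ] ∑[ x' < m ] ∑[ a < m ] 𝟙 (pair? S a x x')  ≡⟨ sum-cong-≗ (λ x → sum-cong-≗ (∑-𝟙-pair? x)) ⟩
    ∑[ x < m ] ∑[ x' < m ] (𝟙 (x ∈? S) * 𝟙 (x' ∈? S))
      ≡⟨ sum-cong-≗ (λ x → *-distribˡ-sum (𝟙 (x ∈? S)) (λ x' → 𝟙 (x' ∈? S))) ⟨
    ∑[ x < m ] (𝟙 (x ∈? S) * ∑[ x' < m ] 𝟙 (x' ∈? S))
      ≡⟨ *-distribʳ-sum (∑[ x' < m ] 𝟙 (x' ∈? S)) (λ x → 𝟙 (x ∈? S)) ⟨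
    ∑[ x < m ] 𝟙 (x ∈? S) * ∑[ x' < m ] 𝟙 (x' ∈? S)       ≡⟨ cong₂ _*_ (∑-𝟙-∈ S) (∑-𝟙-∈ S) ⟩
    ∣ S ∣ * ∣ S ∣                                         ∎
    where open ≡-Reasoning

  pairCount-zero : pairCount m S Fin.zero ≡ ∣ S ∣
  pairCount-zero = begin
    pairCount m S Fin.zero                                              ≡⟨ pairCount≡∑ S Fin.zero ⟩
    ∑[ x < m ] ∑[ x' < m ] 𝟙 (pair? S Fin.zero x x')                     ≡⟨ sum-cong-≗ (λ x → sum-cong-≗ (𝟙-pair? S Fin.zero x)) ⟩
    ∑[ x < m ] ∑[ x' < m ] (𝟙 (x ∈? S) * (𝟙 (x' ∈? S) * 𝟙 (d? x x')))
      ≡⟨ sum-cong-≗ (λ x → *-distribˡ-sum (𝟙 (x ∈? S)) (λ x' → 𝟙 (x' ∈? S) * 𝟙 (d? x x'))) ⟨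
    ∑[ x < m ] (𝟙 (x ∈? S) * ∑[ x' < m ] (𝟙 (x' ∈? S) * 𝟙 (d? x x')))   ≡⟨ sum-cong-≗ (λ x → cong (𝟙 (x ∈? S) *_) (only-x x)) ⟩
    ∑[ x < m ] (𝟙 (x ∈? S) * 𝟙 (x ∈? S))                                ≡⟨ sum-cong-≗ (λ x → 𝟙-idem (x ∈? S)) ⟩
    ∑[ x < m ] 𝟙 (x ∈? S)                                               ≡⟨ ∑-𝟙-∈ S ⟩
    ∣ S ∣                                                               ∎
    where
    open ≡-Reasoning
    d? : ∀ x x' → Dec (DiffMod m x x' Fin.zero)
    d? x x' = diffMod? m x x' Fin.zero
    only-x : ∀ x → ∑[ x' < m ] (𝟙 (x' ∈? S) * 𝟙 (d? x x')) ≡ 𝟙 (x ∈? S)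
    only-x x = ∑-*𝟙-unique (d? x) (DiffMod-refl x) (sym ∘ DiffMod-zero⇒≡) (λ x' → 𝟙 (x' ∈? S))

m*[m∸1]+m≡m*m : ∀ m → m * (m ∸ 1) + m ≡ m * m
m*[m∸1]+m≡m*m zero    = refl
m*[m∸1]+m≡m*m (suc m) = trans (ℕP.+-comm (suc m * m) (suc m)) (sym (ℕP.*-suc (suc m) m))

[1+m]*m≡m*[m∸1]+2*m : ∀ m → suc m * m ≡ m * (m ∸ 1) + 2 * m
[1+m]*m≡m*[m∸1]+2*m zero    = refl
[1+m]*m≡m*[m∸1]+2*m (suc m) = identity m
  where
  identity : ∀ m → suc (suc m) * suc m ≡ suc m * m + 2 * suc m
  identity = solve-∀

-- The nonzero residues of ℤ_m = Fin (suc n) are the Fin.suc i, so Σ_{a≠0} f a is ∑[ i < n ] f (Fin.suc i).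
∑-pairCount-nonzero : ∀ {n} (S : Subset (suc n)) → ∑[ i < n ] pairCount (suc n) S (Fin.suc i) ≡ ∣ S ∣ * (∣ S ∣ ∸ 1)
∑-pairCount-nonzero {n} S = ℕP.+-cancelˡ-≡ ∣ S ∣ T (∣ S ∣ * (∣ S ∣ ∸ 1)) (begin
  ∣ S ∣ + T                              ≡⟨ cong (_+ T) (pairCount-zero S) ⟨
  ∑[ a < suc n ] pairCount (suc n) S a  ≡⟨ ∑-pairCount S ⟩
  ∣ S ∣ * ∣ S ∣                          ≡⟨ m*[m∸1]+m≡m*m ∣ S ∣ ⟨
  ∣ S ∣ * (∣ S ∣ ∸ 1) + ∣ S ∣             ≡⟨ ℕP.+-comm _ ∣ S ∣ ⟩
  ∣ S ∣ + ∣ S ∣ * (∣ S ∣ ∸ 1)             ∎)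
  where
  open ≡-Reasoning
  T = ∑[ i < n ] pairCount (suc n) S (Fin.suc i)

∑-N-nonzero : ∀ {n} (B D : Subset (suc n)) →
              ∑[ i < n ] N (suc n) B D (Fin.suc i) ≡ ∣ B ∣ * (∣ B ∣ ∸ 1) + ∣ D ∣ * (∣ D ∣ ∸ 1)
∑-N-nonzero {n} B D =
  trans (∑-distrib-+ (λ i → pairCount (suc n) B (Fin.suc i)) (λ i → pairCount (suc n) D (Fin.suc i)))
        (cong₂ _+_ (∑-pairCount-nonzero B) (∑-pairCount-nonzero D))

SDS-sum : ∀ {n B D k₁ k₂ μ} → SDS (suc n) B D k₁ k₂ μ → k₁ * (k₁ ∸ 1) + k₂ * (k₂ ∸ 1) ≡ n * μ
SDS-sum {n} {B} {D} {μ = μ} (refl , refl , N≡μ) = begin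
  ∣ B ∣ * (∣ B ∣ ∸ 1) + ∣ D ∣ * (∣ D ∣ ∸ 1)  ≡⟨ ∑-N-nonzero B D ⟨
  ∑[ i < n ] N (suc n) B D (Fin.suc i)     ≡⟨ sum-cong-≗ (λ i → N≡μ (Fin.suc i) λ ()) ⟩
  ∑[ i < n ] μ                             ≡⟨ ∑-const n μ ⟩
  n * μ                                    ∎
  where open ≡-Reasoning

k+𝟙[k≡μ']≡ν : ∀ {k : ℕ} {μ' : ℤ} {ν} → μ' ℤ.+ 1ℤ ≡ + ν → + k ≡ μ' ⊎ + k ≡ μ' ℤ.+ 1ℤ → k + 𝟙 (+ k ℤ.≟ μ') ≡ ν
k+𝟙[k≡μ']≡ν {k} {μ'} μ'+1≡ν k≈μ' with + k ℤ.≟ μ' | k≈μ'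
... | yes k≡μ' | _           = ℤP.+-injective (trans (cong (ℤ._+ 1ℤ) k≡μ') μ'+1≡ν)
... | no k≢μ'  | inj₁ k≡μ'   = contradiction k≡μ' k≢μ'
... | no _     | inj₂ k≡μ'+1 = trans (ℕP.+-identityʳ k) (ℤP.+-injective (trans k≡μ'+1 μ'+1≡ν))

ASDS-sum : ∀ {n B D k₁ k₂ μ' t ν} → ASDS (suc n) B D k₁ k₂ μ' t → μ' ℤ.+ 1ℤ ≡ + ν →
           k₁ * (k₁ ∸ 1) + k₂ * (k₂ ∸ 1) + t ≡ n * ν
ASDS-sum {n} {B} {D} {μ' = μ'} {ν = ν} (refl , refl , N≈μ' , refl) μ'+1≡ν = begin
  ∣ B ∣ * (∣ B ∣ ∸ 1) + ∣ D ∣ * (∣ D ∣ ∸ 1) + length (filter counted? (allFin (suc n)))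
    ≡⟨ cong₂ _+_ (∑-N-nonzero B D) (sym (length-filter-tabulate counted? id)) ⟨
  ∑[ i < n ] N' i + ∑[ i < n ] 𝟙 (+ N' i ℤ.≟ μ')   ≡⟨ ∑-distrib-+ N' (λ i → 𝟙 (+ N' i ℤ.≟ μ')) ⟨
  ∑[ i < n ] (N' i + 𝟙 (+ N' i ℤ.≟ μ'))            ≡⟨ sum-cong-≗ (λ i → k+𝟙[k≡μ']≡ν μ'+1≡ν (N≈μ' (Fin.suc i) λ ())) ⟩
  ∑[ i < n ] ν                                    ≡⟨ ∑-const n ν ⟩
  n * ν                                           ∎
  where
  open ≡-Reasoning
  N' = λ i → N (suc n) B D (Fin.suc i)
  counted? = λ a → ¬? (toℕ a ≟ 0) ×-dec (+ N (suc n) B D a ℤ.≟ μ')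

removal-size : ∀ {n B B' D k₁ k₂ μ t} → SDS (suc n) B D k₁ k₂ μ →
               ASDS (suc n) B' D (k₁ ∸ 1) k₂ (+ μ ℤ.- 1ℤ) t → t ≡ 2 * (k₁ ∸ 1)
removal-size {n} {B} {B'} {D} {k₁} {k₂} {μ} {t} sds asds = ℕP.+-cancelˡ-≡ (j * (j ∸ 1) + P) t (2 * j) (begin
  j * (j ∸ 1) + P + t      ≡⟨ ASDS-sum {B = B'} {D} asds (//-rightDividesˡ 1ℤ (+ μ)) ⟩
  n * μ                    ≡⟨ SDS-sum {B = B} {D} sds ⟨
  k₁ * j + P               ≡⟨ cong (_+ P) (pairs k₁) ⟩
  j * (j ∸ 1) + 2 * j + P  ≡⟨ xy∙z≈xz∙y (j * (j ∸ 1)) (2 * j) P ⟩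
  j * (j ∸ 1) + P + 2 * j  ∎)
  where
  open ≡-Reasoning
  j = k₁ ∸ 1
  P = k₂ * (k₂ ∸ 1)
  pairs : ∀ k → k * (k ∸ 1) ≡ (k ∸ 1) * (k ∸ 1 ∸ 1) + 2 * (k ∸ 1)
  pairs zero    = refl
  pairs (suc k) = [1+m]*m≡m*[m∸1]+2*m k

addition-size : ∀ {n B B' D k₁ k₂ μ t} → SDS (suc n) B D k₁ k₂ μ →
                ASDS (suc n) B' D (k₁ + 1) k₂ (+ μ) t → 2 * t ≡ n → t ≡ 2 * k₁
addition-size {n} {B} {B'} {D} {k} {k₂} {μ} {t} sds asds 2t≡n =
  sym (ℕP.+-cancelʳ-≡ t (2 * k) t (ℕP.+-cancelˡ-≡ (n * μ) (2 * k + t) (t + t) (begin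
  n * μ + (2 * k + t)            ≡⟨ cong (_+ (2 * k + t)) (SDS-sum {B = B} {D} sds) ⟨
  k * (k ∸ 1) + P + (2 * k + t)  ≡⟨ rearrange (k * (k ∸ 1)) P (2 * k) t ⟩
  k * (k ∸ 1) + 2 * k + P + t    ≡⟨ cong (λ x → x + P + t) ([1+m]*m≡m*[m∸1]+2*m k) ⟨
  suc k * k + P + t              ≡⟨ cong (λ x → x * (x ∸ 1) + P + t) (ℕP.+-comm k 1) ⟨
  (k + 1) * (k + 1 ∸ 1) + P + t  ≡⟨ ASDS-sum {B = B'} {D} asds refl ⟩
  n * (μ + 1)                    ≡⟨ ℕP.*-distribˡ-+ n μ 1 ⟩
  n * μ + n * 1                  ≡⟨ cong (λ x → n * μ + x) (trans (ℕP.*-identityʳ n) (sym 2t≡n)) ⟩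
  n * μ + 2 * t                  ≡⟨ cong (λ x → n * μ + (t + x)) (ℕP.+-identityʳ t) ⟩
  n * μ + (t + t)                ∎)))
  where
  open ≡-Reasoning
  P = k₂ * (k₂ ∸ 1)
  rearrange : ∀ a b c d → a + b + (c + d) ≡ a + c + b + d
  rearrange = solve-∀

/-cross : ∀ a b c d → a * suc d ≡ b * suc c → + a / suc c ≡ + b / suc d
/-cross a b c d e = ℚP.fromℚᵘ-cong {mkℚᵘ (+ a) c} {mkℚᵘ (+ b) d}
  (*≡* (trans (sym (ℤP.pos-* a (suc d))) (trans (cong +_ e) (ℤP.pos-* b (suc c)))))

/1≡/+/-cross : ∀ x a b c d → x * (suc c * suc d) ≡ a * suc d + b * suc c → + x / 1 ≡ + a / suc c ℚ.+ + b / suc d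
/1≡/+/-cross x a b c d e = ℚP.toℚᵘ-injective ≃-sum
  where
  cross : + x ℤ.* + (suc c * suc d) ≡ (+ a ℤ.* + suc d ℤ.+ + b ℤ.* + suc c) ℤ.* + 1
  cross = begin
    + x ℤ.* + (suc c * suc d)                     ≡⟨ ℤP.pos-* x (suc c * suc d) ⟨
    + (x * (suc c * suc d))                       ≡⟨ cong +_ e ⟩
    + (a * suc d + b * suc c)                     ≡⟨ cong₂ ℤ._+_ (ℤP.pos-* a (suc d)) (ℤP.pos-* b (suc c)) ⟩
    + a ℤ.* + suc d ℤ.+ + b ℤ.* + suc c           ≡⟨ ℤP.*-identityʳ _ ⟨
    (+ a ℤ.* + suc d ℤ.+ + b ℤ.* + suc c) ℤ.* + 1 ∎
    where open ≡-Reasoning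
  ≃-sum : toℚᵘ (+ x / 1) ℚᵘ.≃ toℚᵘ (+ a / suc c ℚ.+ + b / suc d)
  ≃-sum = begin
    toℚᵘ (+ x / 1)                              ≈⟨ ℚP.toℚᵘ-fromℚᵘ (mkℚᵘ (+ x) 0) ⟩
    mkℚᵘ (+ x) 0                                ≈⟨ *≡* cross ⟩
    mkℚᵘ (+ a) c ℚᵘ.+ mkℚᵘ (+ b) d              ≈⟨ ℚᵘP.+-cong (ℚP.toℚᵘ-fromℚᵘ (mkℚᵘ (+ a) c)) (ℚP.toℚᵘ-fromℚᵘ (mkℚᵘ (+ b) d)) ⟨
    toℚᵘ (+ a / suc c) ℚᵘ.+ toℚᵘ (+ b / suc d)  ≈⟨ ℚP.toℚᵘ-homo-+ (+ a / suc c) (+ b / suc d) ⟨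
    toℚᵘ (+ a / suc c ℚ.+ + b / suc d)          ∎
    where open ℚᵘP.≃-Reasoning

+[m*m]-+m≡+[m*[m∸1]] : ∀ m → + (m * m) ℤ.- + m ≡ + (m * (m ∸ 1))
+[m*m]-+m≡+[m*[m∸1]] m =
  trans (cong (λ x → + x ℤ.- + m) (sym (m*[m∸1]+m≡m*m m))) (//-rightDividesʳ (+ m) (+ (m * (m ∸ 1))))

μ-value : ∀ n k₁ k₂ μ a → k₁ * (k₁ ∸ 1) + k₂ * (k₂ ∸ 1) ≡ suc n * μ → a * suc n ≡ 16 * (k₁ * (k₁ ∸ 1)) →
          + μ / 1 ≡ + a / 16 ℚ.+ (+ (k₂ * k₂) ℤ.- + k₂) / suc n
μ-value n k₁ k₂ μ a sds a*n =
  trans (/1≡/+/-cross μ a P 15 n cross) (cong (λ z → + a / 16 ℚ.+ z / suc n) (sym (+[m*m]-+m≡+[m*[m∸1]] k₂)))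
  where
  open ≡-Reasoning
  P = k₂ * (k₂ ∸ 1)
  cross : μ * (16 * suc n) ≡ a * suc n + P * 16
  cross = begin
    μ * (16 * suc n)               ≡⟨ ℕP.*-comm μ (16 * suc n) ⟩
    16 * suc n * μ                 ≡⟨ ℕP.*-assoc 16 (suc n) μ ⟩
    16 * (suc n * μ)               ≡⟨ cong (16 *_) sds ⟨
    16 * (k₁ * (k₁ ∸ 1) + P)       ≡⟨ ℕP.*-distribˡ-+ 16 (k₁ * (k₁ ∸ 1)) P ⟩
    16 * (k₁ * (k₁ ∸ 1)) + 16 * P  ≡⟨ cong₂ _+_ a*n (ℕP.*-comm P 16) ⟨
    a * suc n + P * 16             ∎

removal-parameters : ∀ {n B B' D k₁ k₂ μ t} → SDS (suc (suc n)) B D k₁ k₂ μ →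
                     ASDS (suc (suc n)) B' D (k₁ ∸ 1) k₂ (+ μ ℤ.- 1ℤ) t → 2 * t ≡ suc n →
                     (+ k₁ / 1 ≡ + (suc (suc n) + 3) / 4) ×
                     (+ μ / 1 ≡ + (suc (suc n) + 3) / 16 ℚ.+ (+ (k₂ * k₂) ℤ.- + k₂) / suc n)
removal-parameters {B = B} {B'} {D} {k₁ = zero} sds asds 2t≡n =
  contradiction (trans (sym 2t≡n) (cong (2 *_) (removal-size {B = B} {B'} {D} sds asds))) λ ()
removal-parameters {n} {B} {B'} {D} {suc K} {k₂} {μ} sds asds 2t≡n =
  /-cross (suc K) (suc (suc n) + 3) 0 3 (trans (k₁-identity K) (cong (λ x → (suc x + 3) * 1) (sym n≡4K))) ,
  μ-value n (suc K) k₂ μ (suc (suc n) + 3) (SDS-sum {B = B} {D} sds)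
          (trans (cong (λ x → (suc x + 3) * x) n≡4K) (μ-identity K))
  where
  n≡4K : suc n ≡ 2 * (2 * K)
  n≡4K = trans (sym 2t≡n) (cong (2 *_) (removal-size {B = B} {B'} {D} sds asds))
  k₁-identity : ∀ K → suc K * 4 ≡ (suc (2 * (2 * K)) + 3) * 1
  k₁-identity = solve-∀
  μ-identity : ∀ K → (suc (2 * (2 * K)) + 3) * (2 * (2 * K)) ≡ 16 * (suc K * K)
  μ-identity = solve-∀

addition-parameters : ∀ {n B B' D k₁ k₂ μ t} → SDS (suc (suc n)) B D k₁ k₂ μ →
                      ASDS (suc (suc n)) B' D (k₁ + 1) k₂ (+ μ) t → 2 * t ≡ suc n →
                      (+ k₁ / 1 ≡ + suc n / 4) ×
                      (+ μ / 1 ≡ (+ suc (suc n) ℤ.- + 5) / 16 ℚ.+ (+ (k₂ * k₂) ℤ.- + k₂) / suc n)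
addition-parameters {B = B} {B'} {D} {k₁ = zero} sds asds 2t≡n =
  contradiction (trans (sym 2t≡n) (cong (2 *_) (addition-size {B = B} {B'} {D} sds asds 2t≡n))) λ ()
addition-parameters {n} {B} {B'} {D} {suc K} {k₂} {μ} sds asds 2t≡n =
  /-cross (suc K) (suc n) 0 3 (trans (k₁-identity K) (cong (_* 1) (sym n≡4k₁))) ,
  subst (λ a → + μ / 1 ≡ a / 16 ℚ.+ (+ (k₂ * k₂) ℤ.- + k₂) / suc n) (sym m-5≡4K)
        (μ-value n (suc K) k₂ μ (2 * (2 * K)) (SDS-sum {B = B} {D} sds)
                 (trans (cong (2 * (2 * K) *_) n≡4k₁) (μ-identity K)))
  where
  n≡4k₁ : suc n ≡ 2 * (2 * suc K)
  n≡4k₁ = trans (sym 2t≡n) (cong (2 *_) (addition-size {B = B} {B'} {D} sds asds 2t≡n))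
  shift : ∀ K → suc (2 * (2 * suc K)) ≡ 2 * (2 * K) + 5
  shift = solve-∀
  m-5≡4K : + suc (suc n) ℤ.- + 5 ≡ + (2 * (2 * K))
  m-5≡4K = trans (cong (λ x → + x ℤ.- + 5) (trans (cong suc n≡4k₁) (shift K))) (//-rightDividesʳ (+ 5) (+ (2 * (2 * K))))
  k₁-identity : ∀ K → suc K * 4 ≡ 2 * (2 * suc K) * 1
  k₁-identity = solve-∀
  μ-identity : ∀ K → 2 * (2 * K) * (2 * (2 * suc K)) ≡ 16 * (suc K * K)
  μ-identity = solve-∀

-- Only the sizes of B - b and B ∪ ⁅ b ⁆ enter the argument.
lemma3 : (m : ℕ) → ⦃ _ : NonZero (m ∸ 1) ⦄ → (B D : Subset m) → (k₁ k₂ μ t : ℕ)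
    → SDS m B D k₁ k₂ μ
    → 2 ℕ.* t ≡ m ∸ 1
    → ((∃[ b ] (b ∈ B × ASDS m (B - b) D (k₁ ∸ 1) k₂ (+ μ ℤ.- + 1) t))
         → (+ k₁ / 1 ≡ + (m ℕ.+ 3) / 4)
           × (+ μ / 1 ≡ (+ (m ℕ.+ 3) / 16) ℚ.+ ((+ (k₂ ℕ.* k₂) ℤ.- + k₂) / (m ∸ 1))))
      × ((∃[ b ] (b ∉ B ∪ D × ASDS m (B ∪ ⁅ b ⁆) D (k₁ ℕ.+ 1) k₂ (+ μ) t))
         → (+ k₁ / 1 ≡ + (m ∸ 1) / 4)
           × (+ μ / 1 ≡ ((+ m ℤ.- + 5) / 16) ℚ.+ ((+ (k₂ ℕ.* k₂) ℤ.- + k₂) / (m ∸ 1))))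
lemma3 (suc (suc n)) B D k₁ k₂ μ t sds 2t≡m-1 =
  (λ { (b , _ , asds) → removal-parameters {B = B} {B - b} {D} sds asds 2t≡m-1 }) ,
  (λ { (b , _ , asds) → addition-parameters {B = B} {B ∪ ⁅ b ⁆} {D} sds asds 2t≡m-1 })
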